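{- Let $X,Y\in\Sigma^{\le n}$ and let $k\ge0$, $p$ be integers with $2\ln n\le p\le n$. Run the following randomized procedure: set $x:=0$, $y:=0$, $c:=0$; while $x<|X|$ and $y<|Y|$: draw a fresh independent bit $s$ with $\Pr[s=1]=\frac{2\ln n}{p}$; if $s=1$ and $X[x]\ne Y[y]$ (call such an iteration a mismatch iteration), draw a fresh unbiased bit $r$ and set $x:=x+r$, $y:=y+(1-r)$, $c:=c+1$; otherwise set $x:=x+1$, $y:=y+1$. Let $t$ be the total number of iterations, let $D_0$ be the value of $D:=\mathsf{IDD}(X[x\mathinner{.\,.}|X|),Y[y\mathinner{.\,.}|Y|))$ before the first iteration, and let $D_i$ be the value of $D$ after iteration $i\in[1\mathinner{.\,.} t]$. Then $D_0=\mathsf{IDD}(X,Y)\le2\mathsf{ED}(X,Y)$, and for each $i\in[1\mathinner{.\,.} t]$: (a) $D_i$ is a non-negative integer; (b) if iteration $i$ is not a mismatch iteration, then $D_i\le D_{i-1}$; (c) if iteration $i$ is a mismatch iteration, then $D_i=D_{i-1}-1$ or $D_i=D_{i-1}+1$, and $D_i=D_{i-1}-1$ holds for at least one of the two possible values of the bit $r$ drawn in that iteration; (d) if $D_{i-1}=0$, then $D_i=0$.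
   Context: Strings are indexed from $0$; $X[a\mathinner{.\,.} b)=X[a]\cdots X[b-1]$. $\mathsf{ED}$ is edit distance (insertions, deletions, substitutions). $\mathsf{IDD}(A,B)$ (indel distance) is the minimum number of character insertions and deletions needed to transform $A$ into $B$. -}

module Defs where

open import Data.Nat using (ℕ; zero; suc; _+_; _≤_; _<ᵇ_)
open import Data.Bool using (Bool; true; false; _∧_; if_then_else_; not)
open import Data.List using (List; []; _∷_; _++_; drop; length)
open import Data.Product using (Σ; ∃; _×_; _,_)
open import Relation.Nullary using (Dec; yes; no; ⌊_⌋)
open import Relation.Binary.PropositionalEquality using (_≡_)
open import Relation.Binary.Definitions using (DecidableEquality)

module _ {Σ' : Set} where

  data Del : List Σ' → List Σ' → Set where
    del : ∀ u a v → Del (u ++ a ∷ v) (u ++ v)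

  data Ins : List Σ' → List Σ' → Set where
    ins : ∀ u a v → Ins (u ++ v) (u ++ a ∷ v)

  data Sub : List Σ' → List Σ' → Set where
    sub : ∀ u a b v → Sub (u ++ a ∷ v) (u ++ b ∷ v)

  data IndelOp (A B : List Σ') : Set where
    i-del : Del A B → IndelOp A B
    i-ins : Ins A B → IndelOp A B

  data EditOp (A B : List Σ') : Set where
    e-del : Del A B → EditOp A B
    e-ins : Ins A B → EditOp A B
    e-sub : Sub A B → EditOp A B

  data Reach (R : List Σ' → List Σ' → Set) : List Σ' → List Σ' → ℕ → Set where
    done : ∀ {A} → Reach R A A 0
    step : ∀ {A A' B k} → R A A' → Reach R A' B k → Reach R A B (suc k)

  IsMinDist : (List Σ' → List Σ' → Set) → List Σ' → List Σ' → ℕ → Set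
  IsMinDist R A B d = Reach R A B d × (∀ k → Reach R A B k → d ≤ k)

  IsIDD : List Σ' → List Σ' → ℕ → Set
  IsIDD = IsMinDist IndelOp

  IsED : List Σ' → List Σ' → ℕ → Set
  IsED = IsMinDist EditOp

module Proc {Σ' : Set} (_≟_ : DecidableEquality Σ') (X Y : List Σ') where

  State : Set
  State = ℕ × ℕ × ℕ

  running : State → Bool
  running (x , y , c) = (x <ᵇ length X) ∧ (y <ᵇ length Y)

  -- Does X[x] ≠ Y[y] hold?  (false if either index is out of range)
  differ : List Σ' → List Σ' → Bool
  differ (a ∷ _) (b ∷ _) = not ⌊ a ≟ b ⌋
  differ _ _ = false

  mismatchAt : State → Bool
  mismatchAt (x , y , c) = differ (drop x X) (drop y Y)

  body : Bool → Bool → State → State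
  body s r (x , y , c) =
    if s ∧ mismatchAt (x , y , c)
    then (if r then (suc x , y , suc c) else (x , suc y , suc c))
    else (suc x , suc y , c)

  isMismatchIter : Bool → State → Bool
  isMismatchIter s st = s ∧ mismatchAt st

  -- state ss rs i : state after i iterations (stays fixed once the loop stopped);
  -- iteration i+1 uses the bits ss i and rs i.
  state : (ℕ → Bool) → (ℕ → Bool) → ℕ → State
  state ss rs zero = (0 , 0 , 0)
  state ss rs (suc i) =
    if running (state ss rs i) then body (ss i) (rs i) (state ss rs i) else state ss rs i

  IsD : State → ℕ → Set
  IsD (x , y , c) d = IsIDD (drop x X) (drop y Y) d

module Submission where

-- D is the indel distance between the unread suffixes of X and
-- Y, so everything reduces to properties of indel distance.  We compute it by
-- the textbook recursion  idd : List → List → ℕ  (drop equal first letters,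
-- otherwise pay one and drop the first letter of either string) and show:
--   * idd is the indel distance: it is realised by an explicit sequence of
--     operations, and one indel operation changes idd by at most one, so no
--     shorter sequence exists; since a substitution is two indels, idd ≤ 2·ED;
--   * idd A B has the parity of |A| + |B|;
--   * removing the first letter of both strings never increases idd;
--   * if a ≠ b, then idd (a ∷ A) (b ∷ B) = 1 + min (idd A (b ∷ B)) (idd (a ∷ A) B),
--     and both candidates have equal parity and differ by at most two, hence
--     each is one below or one above the minimum plus one.

open import Defs
open import Data.Nat using (ℕ; zero; suc; _+_; _*_; _≤_; _⊓_; _<ᵇ_; s≤s; parity)
open import Data.Nat.Properties
open import Data.Parity.Base using (_⁻¹)
open import Data.Parity.Properties using (suc-homo-⁻¹; ⁻¹-injective)
open import Data.Bool using (Bool; true; false; _∧_; if_then_else_)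
open import Data.List using (List; []; _∷_; _++_; length; drop)
open import Data.Product using (∃; _×_; _,_; proj₁; proj₂)
open import Data.Sum using (_⊎_; inj₁; inj₂) renaming (map to ⊎-map)
open import Relation.Binary.PropositionalEquality
open import Relation.Binary.Definitions using (DecidableEquality)
open import Relation.Nullary using (Dec; yes; no; ¬_; ⌊_⌋; contradiction)

if-true : ∀ {A : Set} {b} {t e : A} → b ≡ true → (if b then t else e) ≡ t
if-true refl = refl

if-false : ∀ {A : Set} {b} {t e : A} → b ≡ false → (if b then t else e) ≡ e
if-false refl = refl

∧-true : ∀ {p q} → p ∧ q ≡ true → (p ≡ true) × (q ≡ true)
∧-true {true} q≡true = refl , q≡true

Adjacent : ℕ → ℕ → Set
Adjacent m n = (m ≡ suc n) ⊎ (n ≡ suc m)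

parity-suc : ∀ m → parity (suc m) ≡ parity m ⁻¹
parity-suc m = sym (suc-homo-⁻¹ (suc m))

parity-suc-cong : ∀ m n → parity m ≡ parity n → parity (suc m) ≡ parity (suc n)
parity-suc-cong m n e = trans (parity-suc m) (trans (cong _⁻¹ e) (sym (parity-suc n)))

parity-suc-injective : ∀ m n → parity (suc m) ≡ parity (suc n) → parity m ≡ parity n
parity-suc-injective m n e =
  ⁻¹-injective (trans (sym (parity-suc m)) (trans e (parity-suc n)))

parity-⊓ : ∀ {k} p q → parity p ≡ k → parity q ≡ k → parity (p ⊓ q) ≡ k
parity-⊓ p q p≡k q≡k with ⊓-sel p q
... | inj₁ p⊓q≡p rewrite p⊓q≡p = p≡k
... | inj₂ p⊓q≡q rewrite p⊓q≡q = q≡k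

-- If p and q have equal parity and differ by at most two, then p is either
-- min p q or min p q + 2, i.e. adjacent to 1 + min p q.
adjacent-to-min : ∀ p q → parity p ≡ parity q → p ≤ 2 + q → q ≤ 2 + p
                → Adjacent (suc (p ⊓ q)) p
adjacent-to-min zero q _ _ _ = inj₁ refl
adjacent-to-min (suc zero) zero () _ _
adjacent-to-min (suc (suc zero)) zero _ _ _ = inj₂ refl
adjacent-to-min (suc (suc (suc p))) zero _ (s≤s (s≤s ())) _
adjacent-to-min (suc p) (suc q) same p≤ q≤ =
  ⊎-map (cong suc) (cong suc)
        (adjacent-to-min p q (parity-suc-injective p q same) (≤-pred p≤) (≤-pred q≤))

Bracketed : ℕ → ℕ → ℕ → Set
Bracketed d p q = Adjacent d p × Adjacent d q × ((d ≡ suc p) ⊎ (d ≡ suc q))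

bracketed-min : ∀ p q → parity p ≡ parity q → p ≤ 2 + q → q ≤ 2 + p
              → Bracketed (suc (p ⊓ q)) p q
bracketed-min p q same p≤ q≤ =
    adjacent-to-min p q same p≤ q≤
  , subst (λ m → Adjacent (suc m) q) (⊓-comm q p) (adjacent-to-min q p (sym same) q≤ p≤)
  , ⊎-map (cong suc) (cong suc) (⊓-sel p q)

module IndelDistance {Σ' : Set} (_≟_ : DecidableEquality Σ') where

  idd : List Σ' → List Σ' → ℕ
  idd [] B = length B
  idd (a ∷ A) [] = suc (length A)
  idd (a ∷ A) (b ∷ B) =
    if ⌊ a ≟ b ⌋ then idd A B else suc (idd A (b ∷ B) ⊓ idd (a ∷ A) B)

  idd-[]ʳ : ∀ A → idd A [] ≡ length A
  idd-[]ʳ [] = refl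
  idd-[]ʳ (a ∷ A) = refl

  idd-self : ∀ A → idd A A ≡ 0
  idd-self [] = refl
  idd-self (a ∷ A) with a ≟ a
  ... | yes _ = idd-self A
  ... | no a≢a = contradiction refl a≢a

  idd-consˡ-≤ : ∀ a A B → idd (a ∷ A) B ≤ suc (idd A B)
  idd-consʳ-≥ : ∀ b A B → idd A B ≤ suc (idd A (b ∷ B))
  idd-consˡ-≤ a A [] = s≤s (≤-reflexive (sym (idd-[]ʳ A)))
  idd-consˡ-≤ a A (b ∷ B) with a ≟ b
  ... | yes refl = idd-consʳ-≥ a A B
  ... | no _ = s≤s (m⊓n≤m _ _)
  idd-consʳ-≥ b [] B = m≤n+m (length B) 2
  idd-consʳ-≥ b (c ∷ A) B with c ≟ b
  ... | yes refl = idd-consˡ-≤ c A B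
  ... | no _ = ⊓-glb (≤-trans (idd-consˡ-≤ c A B) (s≤s (idd-consʳ-≥ b A B))) (m≤n+m _ 2)

  idd-consʳ-≤ : ∀ b A B → idd A (b ∷ B) ≤ suc (idd A B)
  idd-consˡ-≥ : ∀ a A B → idd A B ≤ suc (idd (a ∷ A) B)
  idd-consʳ-≤ b [] B = ≤-refl
  idd-consʳ-≤ b (c ∷ A) B with c ≟ b
  ... | yes refl = idd-consˡ-≥ c A B
  ... | no _ = s≤s (m⊓n≤n _ _)
  idd-consˡ-≥ a A [] = ≤-trans (≤-reflexive (idd-[]ʳ A)) (m≤n+m _ 2)
  idd-consˡ-≥ a A (b ∷ B) with a ≟ b
  ... | yes refl = idd-consʳ-≤ a A B
  ... | no _ = ⊓-glb (m≤n+m _ 2) (≤-trans (idd-consʳ-≤ b A B) (s≤s (idd-consˡ-≥ a A B)))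

  -- A bound "idd A B ≤ 1 + idd A' B for all B" survives prepending a common
  -- letter to A and A'; this lifts the front bounds to edits at any position.
  cons-bound : ∀ c {A A'} → (∀ B → idd A B ≤ suc (idd A' B))
             → ∀ B → idd (c ∷ A) B ≤ suc (idd (c ∷ A') B)
  cons-bound c {A} {A'} bound [] =
    s≤s (subst₂ _≤_ (idd-[]ʳ A) (cong suc (idd-[]ʳ A')) (bound []))
  cons-bound c bound (b ∷ B) with c ≟ b
  ... | yes _ = bound B
  ... | no _ = s≤s (⊓-mono-≤ (bound (b ∷ B)) (cons-bound c bound B))

  idd-indel : ∀ {A A'} → IndelOp A A' → ∀ B → idd A B ≤ suc (idd A' B)
  idd-indel (i-del (del u a v)) = delete-at u
    where
    delete-at : ∀ u → ∀ B → idd (u ++ a ∷ v) B ≤ suc (idd (u ++ v) B)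
    delete-at [] = idd-consˡ-≤ a v
    delete-at (c ∷ u) = cons-bound c (delete-at u)
  idd-indel (i-ins (ins u a v)) = insert-at u
    where
    insert-at : ∀ u → ∀ B → idd (u ++ v) B ≤ suc (idd (u ++ a ∷ v) B)
    insert-at [] = idd-consˡ-≥ a v
    insert-at (c ∷ u) = cons-bound c (insert-at u)

  idd-lower-bound : ∀ {A B k} → Reach IndelOp A B k → idd A B ≤ k
  idd-lower-bound {A} done = ≤-reflexive (idd-self A)
  idd-lower-bound {B = B} (step op ops) = ≤-trans (idd-indel op B) (s≤s (idd-lower-bound ops))

  -- ... and, a substitution being a deletion followed by an insertion, half of
  -- idd is a lower bound on the length of any edit sequence.
  idd-edit : ∀ {A A'} → EditOp A A' → ∀ B → idd A B ≤ 2 + idd A' B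
  idd-edit (e-del d) B = ≤-trans (idd-indel (i-del d) B) (n≤1+n _)
  idd-edit (e-ins i) B = ≤-trans (idd-indel (i-ins i) B) (n≤1+n _)
  idd-edit (e-sub (sub u a b v)) B =
    ≤-trans (idd-indel (i-del (del u a v)) B) (s≤s (idd-indel (i-ins (ins u b v)) B))

  idd-edit-bound : ∀ {A B k} → Reach EditOp A B k → idd A B ≤ 2 * k
  idd-edit-bound {A} done = ≤-reflexive (idd-self A)
  idd-edit-bound {A} {B} {suc k} (step {A' = A'} op ops) = begin
    idd A B       ≤⟨ idd-edit op B ⟩
    2 + idd A' B  ≤⟨ +-monoʳ-≤ 2 (idd-edit-bound ops) ⟩
    2 + 2 * k     ≡⟨ *-suc 2 k ⟨
    2 * suc k     ∎
    where open ≤-Reasoning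

  cons-indel : ∀ (c : Σ') {A A'} → IndelOp A A' → IndelOp (c ∷ A) (c ∷ A')
  cons-indel c (i-del (del u a v)) = i-del (del (c ∷ u) a v)
  cons-indel c (i-ins (ins u a v)) = i-ins (ins (c ∷ u) a v)

  cons-reach : ∀ (c : Σ') {A B k} → Reach IndelOp A B k → Reach IndelOp (c ∷ A) (c ∷ B) k
  cons-reach c done = done
  cons-reach c (step op ops) = step (cons-indel c op) (cons-reach c ops)

  reach-step : ∀ {a A b B e p q} (a≟b : Dec (a ≡ b))
             → Reach IndelOp A B e → Reach IndelOp A (b ∷ B) p → Reach IndelOp (a ∷ A) B q
             → Reach IndelOp (a ∷ A) (b ∷ B) (if ⌊ a≟b ⌋ then e else suc (p ⊓ q))
  reach-step (yes refl) same _ _ = cons-reach _ same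
  reach-step {a} {A} {b} {B} {p = p} {q} (no _) _ delete-a insert-b with ⊓-sel p q
  ... | inj₁ min≡p =
    step (i-del (del [] a A)) (subst (Reach IndelOp A (b ∷ B)) (sym min≡p) delete-a)
  ... | inj₂ min≡q =
    step (i-ins (ins [] b (a ∷ A)))
         (subst (Reach IndelOp (b ∷ a ∷ A) (b ∷ B)) (sym min≡q) (cons-reach b insert-b))

  idd-reach : ∀ A B → Reach IndelOp A B (idd A B)
  idd-reach [] [] = done
  idd-reach [] (b ∷ B) = step (i-ins (ins [] b [])) (cons-reach b (idd-reach [] B))
  idd-reach (a ∷ A) [] =
    step (i-del (del [] a A)) (subst (Reach IndelOp A []) (idd-[]ʳ A) (idd-reach A []))
  idd-reach (a ∷ A) (b ∷ B) =
    reach-step (a ≟ b) (idd-reach A B) (idd-reach A (b ∷ B)) (idd-reach (a ∷ A) B)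

  idd-isIDD : ∀ A B → IsIDD A B (idd A B)
  idd-isIDD A B = idd-reach A B , λ k ops → idd-lower-bound ops

  isIDD-unique : ∀ {A B d} → IsIDD A B d → d ≡ idd A B
  isIDD-unique {A} {B} (ops , minimal) = ≤-antisym (minimal _ (idd-reach A B)) (idd-lower-bound ops)

  idd≤2ed : ∀ {A B d e} → IsIDD A B d → IsED A B e → d ≤ 2 * e
  idd≤2ed isIDD (ops , _) = ≤-trans (≤-reflexive (isIDD-unique isIDD)) (idd-edit-bound ops)

  -- Every indel operation changes |A| + |B| by one, so idd A B ≡ |A| + |B| (mod 2).
  idd-parity : ∀ A B → parity (idd A B) ≡ parity (length A + length B)
  idd-parity [] B = refl
  idd-parity (a ∷ A) [] = cong parity (sym (+-identityʳ (suc (length A))))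
  idd-parity (a ∷ A) (b ∷ B)
    with a ≟ b | idd-parity A B | idd-parity A (b ∷ B) | idd-parity (a ∷ A) B
  ... | yes _ | both | _ | _ =
    trans both (cong (λ n → parity (suc n)) (sym (+-suc (length A) (length B))))
  ... | no _ | _ | delete-a | insert-b =
    parity-suc-cong (idd A (b ∷ B) ⊓ idd (a ∷ A) B) (length A + suc (length B))
      (parity-⊓ (idd A (b ∷ B)) (idd (a ∷ A) B) delete-a
                (trans insert-b (cong parity (sym (+-suc (length A) (length B))))))

  idd-diagonal : ∀ a A b B → idd A B ≤ idd (a ∷ A) (b ∷ B)
  idd-diagonal a A b B with a ≟ b
  ... | yes _ = ≤-refl
  ... | no _ = ⊓-glb (idd-consʳ-≥ b A B) (idd-consˡ-≥ a A B)

  idd-mismatch : ∀ a A b B → ¬ a ≡ b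
               → Bracketed (idd (a ∷ A) (b ∷ B)) (idd A (b ∷ B)) (idd (a ∷ A) B)
  idd-mismatch a A b B a≢b with a ≟ b
  ... | yes a≡b = contradiction a≡b a≢b
  ... | no _ = bracketed-min (idd A (b ∷ B)) (idd (a ∷ A) B) same-parity
                 (≤-trans (idd-consʳ-≤ b A B) (s≤s (idd-consˡ-≥ a A B)))
                 (≤-trans (idd-consˡ-≤ a A B) (s≤s (idd-consʳ-≥ b A B)))
    where
    same-parity : parity (idd A (b ∷ B)) ≡ parity (idd (a ∷ A) B)
    same-parity = begin
      parity (idd A (b ∷ B))            ≡⟨ idd-parity A (b ∷ B) ⟩
      parity (length A + suc (length B)) ≡⟨ cong parity (+-suc (length A) (length B)) ⟩
      parity (suc (length A + length B)) ≡⟨ idd-parity (a ∷ A) B ⟨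
      parity (idd (a ∷ A) B)            ∎
      where open ≡-Reasoning

module Analysis {Σ' : Set} (_≟_ : DecidableEquality Σ') (X Y : List Σ') where
  open Proc _≟_ X Y
  open IndelDistance _≟_

  D : State → ℕ
  D (x , y , c) = idd (drop x X) (drop y Y)

  D-isD : ∀ st → IsD st (D st)
  D-isD (x , y , c) = idd-isIDD (drop x X) (drop y Y)

  isD-unique : ∀ st {d} → IsD st d → d ≡ D st
  isD-unique (x , y , c) = isIDD-unique

  transfer : ∀ (R : ℕ → ℕ → Set) st st' → R (D st) (D st')
           → ∀ d d' → IsD st d → IsD st' d' → R d d'
  transfer R st st' holds d d' isD isD' =
    subst₂ R (sym (isD-unique st isD)) (sym (isD-unique st' isD')) holds

  zero-stays : ∀ st st' → D st' ≤ D st → IsD st 0 → IsD st' 0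
  zero-stays st st' decrease zero-here =
    subst (IsD st') (n≤0⇒n≡0 (≤-trans decrease (≤-reflexive (sym (isD-unique st zero-here)))))
          (D-isD st')

  diagonal : State → State
  diagonal (x , y , c) = (suc x , suc y , c)

  advance : Bool → State → State
  advance r (x , y , c) = if r then (suc x , y , suc c) else (x , suc y , suc c)

  body-match : ∀ s r st → isMismatchIter s st ≡ false → body s r st ≡ diagonal st
  body-match s r (x , y , c) = if-false

  body-mismatch : ∀ s r st → isMismatchIter s st ≡ true → body s r st ≡ advance r st
  body-mismatch s r (x , y , c) = if-true

  state-suc : ∀ ss rs i → running (state ss rs i) ≡ true
            → state ss rs (suc i) ≡ body (ss i) (rs i) (state ss rs i)
  state-suc ss rs i = if-true

  drop-cons : ∀ (L : List Σ') x → (x <ᵇ length L) ≡ true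
            → ∃ λ a → ∃ λ A → (drop x L ≡ a ∷ A) × (drop (suc x) L ≡ A)
  drop-cons (a ∷ L) zero _ = a , L , refl , refl
  drop-cons (a ∷ L) (suc x) x<len = drop-cons L x x<len

  letters-differ : ∀ a A b B → differ (a ∷ A) (b ∷ B) ≡ true → ¬ a ≡ b
  letters-differ a A b B differ≡true a≡b with a ≟ b
  letters-differ a A b B () a≡b | yes _
  ... | no a≢b = a≢b a≡b

  record Cursor (st : State) : Set where
    field
      a b : Σ'
      A B : List Σ'
      D-here : D st ≡ idd (a ∷ A) (b ∷ B)
      D-diagonal : D (diagonal st) ≡ idd A B
      D-advance-x : D (advance true st) ≡ idd A (b ∷ B)
      D-advance-y : D (advance false st) ≡ idd (a ∷ A) B
      mismatch-letters : mismatchAt st ≡ true → ¬ a ≡ b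

  cursor : ∀ st → running st ≡ true → Cursor st
  cursor (x , y , c) run
    with drop-cons X x (proj₁ (∧-true run)) | drop-cons Y y (proj₂ (∧-true run))
  ... | a , A , X-here , X-next | b , B , Y-here , Y-next = record
    { a = a ; b = b ; A = A ; B = B
    ; D-here = cong₂ idd X-here Y-here
    ; D-diagonal = cong₂ idd X-next Y-next
    ; D-advance-x = cong₂ idd X-next Y-here
    ; D-advance-y = cong₂ idd X-here Y-next
    ; mismatch-letters = λ mismatch →
        letters-differ a A b B (trans (sym (cong₂ differ X-here Y-here)) mismatch)
    }

  D-diagonal-≤ : ∀ st → Cursor st → D (diagonal st) ≤ D st
  D-diagonal-≤ st cur = begin
    D (diagonal st)       ≡⟨ D-diagonal ⟩
    idd A B               ≤⟨ idd-diagonal a A b B ⟩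
    idd (a ∷ A) (b ∷ B)   ≡⟨ D-here ⟨
    D st                  ∎
    where open Cursor cur
          open ≤-Reasoning

  D-mismatch : ∀ st → Cursor st → mismatchAt st ≡ true
             → Bracketed (D st) (D (advance true st)) (D (advance false st))
  D-mismatch st cur mismatch =
    subst (λ d → Bracketed d _ _) (sym D-here)
      (subst₂ (Bracketed _) (sym D-advance-x) (sym D-advance-y)
        (idd-mismatch a A b B (mismatch-letters mismatch)))
    where open Cursor cur

  IterationSpec : State → Bool → State → Set
  IterationSpec st s st' =
      (∃ λ d → IsD st' d)
    × (∀ d d' → isMismatchIter s st ≡ false → IsD st d → IsD st' d' → d' ≤ d)
    × (isMismatchIter s st ≡ true →
         (∀ d d' → IsD st d → IsD st' d' → Adjacent d d')
         × (∃ λ r → ∀ d d' → IsD st d → IsD (body s r st) d' → d ≡ suc d'))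
    × (IsD st 0 → IsD st' 0)

  match-iteration : ∀ {st s} → Cursor st → isMismatchIter s st ≡ false
                  → IterationSpec st s (diagonal st)
  match-iteration {st} cur no-mismatch =
      (D (diagonal st) , D-isD (diagonal st))
    , (λ d d' _ → transfer (λ d d' → d' ≤ d) st (diagonal st) (D-diagonal-≤ st cur) d d')
    , (λ mismatch → contradiction (trans (sym no-mismatch) mismatch) λ ())
    , zero-stays st (diagonal st) (D-diagonal-≤ st cur)

  mismatch-iteration : ∀ {st s} r → Cursor st → isMismatchIter s st ≡ true
                     → IterationSpec st s (advance r st)
  mismatch-iteration {st} {s} r cur mismatch =
      (D (advance r st) , D-isD (advance r st))
    , (λ d d' no-mismatch → contradiction (trans (sym mismatch) no-mismatch) λ ())
    , (λ _ → transfer Adjacent st (advance r st) (adjacent r) , decreasing-bit)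
    , λ zero-here → contradiction (trans (isD-unique st zero-here) (proj₂ descent)) λ ()
    where
    bracket : Bracketed (D st) (D (advance true st)) (D (advance false st))
    bracket = D-mismatch st cur (proj₂ (∧-true mismatch))

    adjacent : ∀ r → Adjacent (D st) (D (advance r st))
    adjacent true = proj₁ bracket
    adjacent false = proj₁ (proj₂ bracket)

    descent : ∃ λ r → D st ≡ suc (D (advance r st))
    descent with proj₂ (proj₂ bracket)
    ... | inj₁ via-x = true , via-x
    ... | inj₂ via-y = false , via-y

    decreasing-bit : ∃ λ r → ∀ d d' → IsD st d → IsD (body s r st) d' → d ≡ suc d'
    decreasing-bit with descent
    ... | r↓ , decreases = r↓ , λ d d' isD isD' →
      transfer (λ d d' → d ≡ suc d') st (advance r↓ st) decreases d d' isD
               (subst (λ st' → IsD st' d') (body-mismatch s r↓ st mismatch) isD')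

  iteration-spec : ∀ st s r → running st ≡ true → IterationSpec st s (body s r st)
  iteration-spec st s r run = by-kind (isMismatchIter s st) refl
    where
    by-kind : ∀ kind → isMismatchIter s st ≡ kind → IterationSpec st s (body s r st)
    by-kind false no-mismatch =
      subst (IterationSpec st s) (sym (body-match s r st no-mismatch))
            (match-iteration (cursor st run) no-mismatch)
    by-kind true mismatch =
      subst (IterationSpec st s) (sym (body-mismatch s r st mismatch))
            (mismatch-iteration r (cursor st run) mismatch)

-- D₀ is IDD(X,Y) by definition, since
-- the initial state reads X and Y from position 0.
lemma6p2 : {Σ' : Set} (_≟_ : DecidableEquality Σ') (n : ℕ) (X Y : List Σ')
    → length X ≤ n → length Y ≤ n
    → let open Proc _≟_ X Y in
      -- D_0 = IDD(X,Y) ≤ 2 ED(X,Y)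
      ((∃ λ d → IsD (state (λ _ → false) (λ _ → false) 0) d)
        × (∀ d → IsD (state (λ _ → false) (λ _ → false) 0) d → IsIDD X Y d)
        × (∀ d e → IsIDD X Y d → IsED X Y e → d ≤ 2 * e))
      -- for every outcome of the random bits and every iteration i+1 ∈ [1..t]
      × ((ss rs : ℕ → Bool) (i : ℕ) → running (state ss rs i) ≡ true →
          -- (a) D_{i+1} is a (non-negative) integer
          (∃ λ d → IsD (state ss rs (suc i)) d)
          -- (b) non-mismatch iteration: D_{i+1} ≤ D_i
          × (∀ d d' → isMismatchIter (ss i) (state ss rs i) ≡ false
               → IsD (state ss rs i) d → IsD (state ss rs (suc i)) d' → d' ≤ d)
          -- (c) mismatch iteration: D_{i+1} = D_i ± 1, and some value of r decreases D
          × (isMismatchIter (ss i) (state ss rs i) ≡ true →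
               (∀ d d' → IsD (state ss rs i) d → IsD (state ss rs (suc i)) d'
                  → (d ≡ suc d') ⊎ (d' ≡ suc d))
               × (∃ λ r → ∀ d d' → IsD (state ss rs i) d
                  → IsD (body (ss i) r (state ss rs i)) d' → d ≡ suc d'))
          -- (d) D_i = 0 implies D_{i+1} = 0
          × (IsD (state ss rs i) 0 → IsD (state ss rs (suc i)) 0))
lemma6p2 _≟_ n X Y _ _ =
    ( (idd X Y , idd-isIDD X Y)
    , (λ _ D₀≡d → D₀≡d)
    , (λ _ _ → idd≤2ed) )
  , λ ss rs i run →
      subst (IterationSpec (state ss rs i) (ss i)) (sym (state-suc ss rs i run))
            (iteration-spec (state ss rs i) (ss i) (rs i) run)
  where
  open IndelDistance _≟_
  open Analysis _≟_ X Y
  open Proc _≟_ X Y
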